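{- Let $s,t\ge 0$ and $a,b\ge1$ be integers and let $B$ be the solution of $B(n)=B(n-s-B(n-a))+B(n-t-B(n-b))$ ($n>c$) with positive initial values $B(i)=\xi_i$ ($1\le i\le c$), and suppose this solution is well defined for all $n$. Then for any integer $m>1$, the recurrence $$A(n)=A\Big(n-ms-\sum_{i=1}^m A(n-ma)\Big)+A\Big(n-mt-\sum_{i=1}^m A(n-mb)\Big)\qquad(n>mc),$$ with initial conditions $\xi_1,\dots,\xi_1,\xi_2,\dots,\xi_2,\dots,\xi_c,\dots,\xi_c$ (each $\xi_i$ repeated $m$ times), also has a unique solution, and this solution is the $m$-interleaving of $B$.
   Context: The $m$-interleaving of a sequence $b_1,b_2,b_3,\dots$ is the sequence in which each term is repeated $m$ times: $b_1,\dots,b_1,b_2,\dots,b_2,\dots$ (each block of length $m$), i.e. the sequence $A$ with $A(mn-j)=b_n$ for $0\le j<m$. -}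

module Defs where

open import Data.Nat using (ℕ; _≤_; _<_; _∸_)
open import Data.Integer using (ℤ; +_; _+_; _-_; _*_)
open import Data.Product using (Σ; _×_)
open import Relation.Binary.PropositionalEquality using (_≡_)

-- Sequences are functions ℕ → ℤ; only indices ≥ 1 are meaningful (index 0 is ignored).
--
-- For B we take μ = 1; for A, μ = m, the term μ·A(n - ma) being the sum
-- Σ_{i=1}^m A(n - ma) of m equal summands.
Rec : (c s t a b μ : ℕ) → (ℕ → ℤ) → Set
Rec c s t a b μ X =
  (n : ℕ) → c < n →
    a < n × b < n ×
    Σ ℕ (λ j → Σ ℕ (λ k →
      1 ≤ j × j < n × 1 ≤ k × k < n ×
      + j ≡ + n - + s - + μ * X (n ∸ a) ×
      + k ≡ + n - + t - + μ * X (n ∸ b) ×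
      X n ≡ X j + X k))

module Submission where

-- Write ⌈k/m⌉ for the block containing the index k when ℕ⁺ is cut into
-- consecutive blocks of length m, so that the m-interleaving of B is
-- A(k) = B(⌈k/m⌉).  An index k lies in block N exactly when k + r = m·N
-- for some remainder r < m; the whole proof works with such pairs (N, r).
--
-- Existence: if n + r = m·N and the recurrence for B at N refers to the
-- index j = N - s - B(N-a), then the recurrence for A at n refers to the
-- index j′ = m·j - r = n - ms - m·A(n-ma), which lies in block j, because
-- n - ma lies in block N - a.  So each branch of A's recurrence at n is
-- the corresponding branch of B's recurrence at N, read in block j.
--
-- Uniqueness: for positive lags a, b every term of a solution of Rec is
-- determined by the earlier ones, so two solutions agreeing on the initial
-- segment 1..c agree everywhere (strong induction).  The initial values of
-- A are the initial values of B read blockwise, which finishes the proof.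

open import Defs
open import Data.Nat using (ℕ; _≤_; _<_; _∸_)
open import Data.Integer using (ℤ; +_) renaming (_<_ to _<ℤ_; _*_ to _*ℤ_)
open import Data.Product using (Σ; _×_)
open import Relation.Binary.PropositionalEquality using (_≡_)
open Data.Nat using (_*_)

open import Data.Nat using (suc; zero; _+_; s≤s; z≤n; _≤?_; s≤s⁻¹)
open import Data.Nat.Properties
open import Data.Nat.DivMod using (_/_; _%_; m≡m%n+[m/n]*n; m%n<n; +-distrib-/-∣ʳ; m<n⇒m/n≡0; m*n/n≡m)
open import Data.Nat.Divisibility using (divides-refl)
open import Data.Nat.Induction using (<-rec)
import Data.Integer as Z
import Data.Integer.Properties as ZP
open import Data.Integer.Tactic.RingSolver using (solve-∀)
open import Data.Product using (_,_)
open import Relation.Binary.PropositionalEquality using (refl; sym; trans; cong; cong₂; subst; module ≡-Reasoning)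
open import Relation.Nullary using (yes; no)

Rec-unique : ∀ {c s t a b μ} {X Y : ℕ → ℤ} → 1 ≤ a → 1 ≤ b →
  Rec c s t a b μ X → Rec c s t a b μ Y →
  ((n : ℕ) → 1 ≤ n → n ≤ c → X n ≡ Y n) →
  (n : ℕ) → 1 ≤ n → X n ≡ Y n
Rec-unique {c} {s} {t} {a} {b} {μ} {X} {Y} 1≤a 1≤b recX recY initial =
  <-rec (λ n → 1 ≤ n → X n ≡ Y n) step
  where
  step : ∀ n → (∀ {i} → i < n → 1 ≤ i → X i ≡ Y i) → 1 ≤ n → X n ≡ Y n
  step n earlier 1≤n with n ≤? c
  ... | yes n≤c = initial n 1≤n n≤c
  ... | no n≰c with recX n (≰⇒> n≰c) | recY n (≰⇒> n≰c)
  ... | a<n , b<n , j , k , 1≤j , j<n , 1≤k , k<n , ejX , ekX , eX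
      | _ , _ , j′ , k′ , _ , _ , _ , _ , ejY , ekY , eY =
    begin
      X n           ≡⟨ eX ⟩
      X j Z.+ X k   ≡⟨ cong₂ Z._+_ (earlier j<n 1≤j) (earlier k<n 1≤k) ⟩
      Y j Z.+ Y k   ≡⟨ cong₂ (λ u v → Y u Z.+ Y v) (same-index s a 1≤a a<n ejX ejY)
                                                (same-index t b 1≤b b<n ekX ekY) ⟩
      Y j′ Z.+ Y k′ ≡⟨ sym eY ⟩
      Y n           ∎
    where
    open ≡-Reasoning
    open Z using (_-_)

    -- The index a branch refers to depends only on the lagged term, which
    -- is an earlier term on which X and Y already agree.
    same-index : ∀ σ α {i i′} → 1 ≤ α → α < n →
      + i  ≡ + n - + σ - + μ Z.* X (n ∸ α) →
      + i′ ≡ + n - + σ - + μ Z.* Y (n ∸ α) → i ≡ i′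
    same-index σ α {i} {i′} 1≤α α<n ei ei′ = ZP.+-injective (begin
      + i                          ≡⟨ ei ⟩
      + n - + σ - + μ Z.* X (n ∸ α) ≡⟨ cong (λ x → + n - + σ - + μ Z.* x) lagged ⟩
      + n - + σ - + μ Z.* Y (n ∸ α) ≡⟨ sym ei′ ⟩
      + i′                         ∎)
      where
      lagged : X (n ∸ α) ≡ Y (n ∸ α)
      lagged = earlier (∸-monoʳ-< 1≤α (<⇒≤ α<n)) (m<n⇒0<n∸m α<n)

lift-+≡* : ∀ u v w z → u + v ≡ w * z → + u Z.+ + v ≡ + w Z.* + z
lift-+≡* u v w z e = trans (sym (ZP.pos-+ u v)) (trans (cong +_ e) (ZP.pos-* w z))

scaled-index : ∀ m s n r N j j′ (x : ℤ) → n + r ≡ m * N → j′ + r ≡ m * j →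
  + j ≡ + N Z.- + s Z.- + 1 Z.* x →
  + j′ ≡ + n Z.- + (m * s) Z.- + m Z.* x
scaled-index m s n r N j j′ x n+r≡mN j′+r≡mj ej = begin
  + j′                                             ≡⟨ add-sub (+ j′) (+ r) ⟩
  (+ j′ Z.+ + r) Z.- + r                           ≡⟨ cong (Z._- + r) (lift-+≡* j′ r m j j′+r≡mj) ⟩
  + m Z.* + j Z.- + r                              ≡⟨ cong (λ y → + m Z.* y Z.- + r) ej ⟩
  + m Z.* (+ N Z.- + s Z.- + 1 Z.* x) Z.- + r      ≡⟨ regroup (+ m) (+ N) (+ s) x (+ r) ⟩
  (+ m Z.* + N Z.- + r) Z.- + m Z.* + s Z.- + m Z.* x
    ≡⟨ cong (λ y → y Z.- + r Z.- + m Z.* + s Z.- + m Z.* x) (sym (lift-+≡* n r m N n+r≡mN)) ⟩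
  (+ n Z.+ + r) Z.- + r Z.- + m Z.* + s Z.- + m Z.* x
    ≡⟨ cong₂ (λ y z → y Z.- z Z.- + m Z.* x) (sym (add-sub (+ n) (+ r))) (sym (ZP.pos-* m s)) ⟩
  + n Z.- + (m * s) Z.- + m Z.* x                  ∎
  where
  open ≡-Reasoning

  add-sub : ∀ (y r : ℤ) → y ≡ (y Z.+ r) Z.- r
  add-sub = solve-∀

  regroup : ∀ (m N s x r : ℤ) →
    m Z.* (N Z.- s Z.- + 1 Z.* x) Z.- r ≡ (m Z.* N Z.- r) Z.- m Z.* s Z.- m Z.* x
  regroup = solve-∀

module Interleaving (m-1 : ℕ) where

  m : ℕ
  m = suc m-1

  block : ℕ → ℕ
  block k = (k + m-1) / m

  interleave : (ℕ → ℤ) → ℕ → ℤ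
  interleave B k = B (block k)

  block-unique : ∀ {k r N} → k + r ≡ m * N → r < m → block k ≡ N
  block-unique {k} {r} {N} k+r≡mN r<m = begin
    (k + m-1) / m          ≡⟨ cong (_/ m) shifted ⟩
    (u + N * m) / m        ≡⟨ +-distrib-/-∣ʳ u (divides-refl N) ⟩
    u / m + N * m / m      ≡⟨ cong₂ _+_ (m<n⇒m/n≡0 (s≤s (m∸n≤m m-1 r))) (m*n/n≡m N m) ⟩
    N                      ∎
    where
    open ≡-Reasoning
    u : ℕ
    u = m-1 ∸ r
    shifted : k + m-1 ≡ u + N * m
    shifted = begin
      k + m-1       ≡⟨ cong (λ z → k + z) (sym (m+[n∸m]≡n (s≤s⁻¹ r<m))) ⟩
      k + (r + u)   ≡⟨ sym (+-assoc k r u) ⟩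
      k + r + u     ≡⟨ cong (_+ u) k+r≡mN ⟩
      m * N + u     ≡⟨ +-comm (m * N) u ⟩
      u + m * N     ≡⟨ cong (λ z → u + z) (*-comm m N) ⟩
      u + N * m     ∎

  block-spec : ∀ k → Σ ℕ (λ r → r < m × k + r ≡ m * block k)
  block-spec k = r , s≤s (m∸n≤m m-1 rem) , +-cancelʳ-≡ rem _ _ (begin
    k + r + rem       ≡⟨ +-assoc k r rem ⟩
    k + (r + rem)     ≡⟨ cong (λ z → k + z) (m∸n+n≡m rem≤m-1) ⟩
    k + m-1           ≡⟨ m≡m%n+[m/n]*n (k + m-1) m ⟩
    rem + block k * m ≡⟨ +-comm rem _ ⟩
    block k * m + rem ≡⟨ cong (_+ rem) (*-comm (block k) m) ⟩
    m * block k + rem ∎)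
    where
    open ≡-Reasoning
    rem : ℕ
    rem = (k + m-1) % m
    rem≤m-1 : rem ≤ m-1
    rem≤m-1 = s≤s⁻¹ (m%n<n (k + m-1) m)
    r : ℕ
    r = m-1 ∸ rem

  m≤m*n⁺ : ∀ {n} → 1 ≤ n → m ≤ m * n
  m≤m*n⁺ {n} 1≤n = ≤-trans (≤-reflexive (sym (*-identityʳ m))) (*-monoʳ-≤ m 1≤n)

  interleave-block : (B : ℕ → ℤ) (n j : ℕ) → 1 ≤ n → j < m → interleave B (m * n ∸ j) ≡ B n
  interleave-block B n j 1≤n j<m = cong B (block-unique (m∸n+n≡m j≤mn) j<m)
    where
    j≤mn : j ≤ m * n
    j≤mn = ≤-trans (<⇒≤ j<m) (m≤m*n⁺ 1≤n)

  beyond-earlier-blocks : ∀ {n r N x} → n + r ≡ m * N → r < m → x < N → m * x < n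
  beyond-earlier-blocks {n} {r} {N} {x} n+r≡mN r<m x<N = +-cancelˡ-< m (m * x) n (begin-strict
    m + m * x  ≡⟨ sym (*-suc m x) ⟩
    m * suc x  ≤⟨ *-monoʳ-≤ m x<N ⟩
    m * N      ≡⟨ sym n+r≡mN ⟩
    n + r      <⟨ +-monoʳ-< n r<m ⟩
    n + m      ≡⟨ +-comm n m ⟩
    m + n      ∎)
    where open ≤-Reasoning

  in-later-block : ∀ {n r N x} → n + r ≡ m * N → m * x < n → x < N
  in-later-block {n} {r} {N} {x} n+r≡mN mx<n =
    *-cancelˡ-< m x N (<-≤-trans mx<n (≤-trans (m≤m+n n r) (≤-reflexive n+r≡mN)))

  shift-blocks : ∀ {n r N a} → n + r ≡ m * N → m * a ≤ n → (n ∸ m * a) + r ≡ m * (N ∸ a)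
  shift-blocks {n} {r} {N} {a} n+r≡mN ma≤n = begin
    (n ∸ m * a) + r   ≡⟨ sym (+-∸-comm r ma≤n) ⟩
    (n + r) ∸ m * a   ≡⟨ cong (_∸ m * a) n+r≡mN ⟩
    m * N ∸ m * a     ≡⟨ sym (*-distribˡ-∸ m N a) ⟩
    m * (N ∸ a)       ∎
    where open ≡-Reasoning

  initial-block : ∀ {n c} → 1 ≤ n → n ≤ m * c →
    Σ ℕ (λ N → Σ ℕ (λ r → 1 ≤ N × N ≤ c × r < m × n ≡ m * N ∸ r))
  initial-block {n} {c} 1≤n n≤mc with block-spec n
  ... | r , r<m , n+r≡mN =
    block n , r , 1≤N , N≤c , r<m , sym (trans (cong (_∸ r) (sym n+r≡mN)) (m+n∸n≡m n r))
    where
    1≤N : 1 ≤ block n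
    1≤N = in-later-block n+r≡mN (subst (_< n) (sym (*-zeroʳ m)) 1≤n)
    N≤c : block n ≤ c
    N≤c = ≮⇒≥ (λ c<N → <⇒≱ (beyond-earlier-blocks n+r≡mN r<m c<N) n≤mc)

  scaled-branch : ∀ {B : ℕ → ℤ} {n r N} s {a j} → n + r ≡ m * N → r < m → a < N →
    1 ≤ j → j < N → + j ≡ + N Z.- + s Z.- + 1 Z.* B (N ∸ a) →
    m * a < n × Σ ℕ (λ j′ → 1 ≤ j′ × j′ < n ×
      + j′ ≡ + n Z.- + (m * s) Z.- + m Z.* interleave B (n ∸ m * a) ×
      interleave B j′ ≡ B j)
  scaled-branch {B} {n} {r} {N} s {a} {j} n+r≡mN r<m a<N 1≤j j<N ej =
    ma<n , m * j ∸ r , m<n⇒0<n∸m r<mj , ≤-<-trans (m∸n≤m (m * j) r) mj<n ,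
    index , cong B (block-unique j′+r≡mj r<m)
    where
    ma<n : m * a < n
    ma<n = beyond-earlier-blocks n+r≡mN r<m a<N
    mj<n : m * j < n
    mj<n = beyond-earlier-blocks n+r≡mN r<m j<N
    r<mj : r < m * j
    r<mj = <-≤-trans r<m (m≤m*n⁺ 1≤j)
    j′+r≡mj : (m * j ∸ r) + r ≡ m * j
    j′+r≡mj = m∸n+n≡m (<⇒≤ r<mj)
    lagged : interleave B (n ∸ m * a) ≡ B (N ∸ a)
    lagged = cong B (block-unique (shift-blocks n+r≡mN (<⇒≤ ma<n)) r<m)
    index : + (m * j ∸ r) ≡ + n Z.- + (m * s) Z.- + m Z.* interleave B (n ∸ m * a)
    index = trans (scaled-index m s n r N j (m * j ∸ r) (B (N ∸ a)) n+r≡mN j′+r≡mj ej)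
                  (cong (λ x → + n Z.- + (m * s) Z.- + m Z.* x) (sym lagged))

  interleave-Rec : ∀ {c s t a b B} → Rec c s t a b 1 B →
    Rec (m * c) (m * s) (m * t) (m * a) (m * b) m (interleave B)
  interleave-Rec {c} {s} {t} {B = B} recB n mc<n with block-spec n
  ... | r , r<m , n+r≡mN
      with recB (block n) (in-later-block n+r≡mN mc<n)
  ... | a<N , b<N , j , k , 1≤j , j<N , 1≤k , k<N , ej , ek , eB
      with scaled-branch {B} s n+r≡mN r<m a<N 1≤j j<N ej | scaled-branch {B} t n+r≡mN r<m b<N 1≤k k<N ek
  ... | ma<n , j′ , 1≤j′ , j′<n , ej′ , Aj′ | mb<n , k′ , 1≤k′ , k′<n , ek′ , Ak′ =
    ma<n , mb<n , j′ , k′ , 1≤j′ , j′<n , 1≤k′ , k′<n , ej′ , ek′ ,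
    trans eB (sym (cong₂ Z._+_ Aj′ Ak′))

theorem4p3 : (s t a b c : ℕ) → 1 ≤ a → 1 ≤ b →
    (ξ : ℕ → ℤ) → ((i : ℕ) → 1 ≤ i → i ≤ c → + 0 <ℤ ξ i) →
    (B : ℕ → ℤ) → ((i : ℕ) → 1 ≤ i → i ≤ c → B i ≡ ξ i) → Rec c s t a b 1 B →
    (m : ℕ) → 1 < m →
      Σ (ℕ → ℤ) (λ A →
        ((n j : ℕ) → 1 ≤ n → n ≤ c → j < m → A (m * n ∸ j) ≡ ξ n) ×
        Rec (m * c) (m * s) (m * t) (m * a) (m * b) m A ×
        ((A′ : ℕ → ℤ) →
          ((n j : ℕ) → 1 ≤ n → n ≤ c → j < m → A′ (m * n ∸ j) ≡ ξ n) →
          Rec (m * c) (m * s) (m * t) (m * a) (m * b) m A′ →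
          (n : ℕ) → 1 ≤ n → A′ n ≡ A n) ×
        ((n j : ℕ) → 1 ≤ n → j < m → A (m * n ∸ j) ≡ B n))
theorem4p3 s t a b c 1≤a 1≤b ξ _ B B-initial recB zero ()
theorem4p3 s t a b c 1≤a 1≤b ξ _ B B-initial recB (suc m-1) _ =
  interleave B , A-initial , recA , unique , interleave-block B
  where
  open Interleaving m-1

  recA : Rec (m * c) (m * s) (m * t) (m * a) (m * b) m (interleave B)
  recA = interleave-Rec {c} {s} {t} {a} {b} recB

  A-initial : (n j : ℕ) → 1 ≤ n → n ≤ c → j < m → interleave B (m * n ∸ j) ≡ ξ n
  A-initial n j 1≤n n≤c j<m = trans (interleave-block B n j 1≤n j<m) (B-initial n 1≤n n≤c)

  unique : (A′ : ℕ → ℤ) → ((n j : ℕ) → 1 ≤ n → n ≤ c → j < m → A′ (m * n ∸ j) ≡ ξ n) →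
    Rec (m * c) (m * s) (m * t) (m * a) (m * b) m A′ → (n : ℕ) → 1 ≤ n → A′ n ≡ interleave B n
  unique A′ A′-initial recA′ =
    Rec-unique {m * c} {m * s} {m * t} {m * a} {m * b} {m}
      (≤-trans (s≤s z≤n) (m≤m*n⁺ 1≤a)) (≤-trans (s≤s z≤n) (m≤m*n⁺ 1≤b)) recA′ recA agree
    where
    agree : (n : ℕ) → 1 ≤ n → n ≤ m * c → A′ n ≡ interleave B n
    agree n 1≤n n≤mc with initial-block 1≤n n≤mc
    ... | N , r , 1≤N , N≤c , r<m , refl =
      trans (A′-initial N r 1≤N N≤c r<m) (sym (A-initial N r 1≤N N≤c r<m))
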